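{- Let $\mathbf{k}$ be a commutative ring, $q\in\mathbf{k}$, $\pi=\pi_1\pi_2\cdots\pi_n\in S_n$ and $\alpha=(\alpha_1,\dots,\alpha_n)$ a composition with $n$ entries. Then \[ U_{\pi,\alpha}^{q}=\sum_{\substack{i_{1}\leq i_{2}\leq \dots\leq i_{n};\\ j\in\operatorname{Peak}(\pi)\Rightarrow i_{j-1}<i_{j+1}}} q^{|\{j\in\operatorname{Des}(\pi)\,:\,i_{j}=i_{j+1}\}|}\,(q+1)^{|\{i_{1},i_{2},\dots, i_{n}\}|}\,x_{i_{1}}^{\alpha_{1}}x_{i_{2}}^{\alpha_{2}}\cdots x_{i_{n}}^{\alpha_{n}}, \] where the sum is over sequences of positive integers.
   Context: Let $x_1,x_2,\dots$ be commuting indeterminates and work in $\mathbf{k}[[x_1,x_2,\dots]]$. Let $\mathbb{P}=\{1,2,3,\dots\}$ and let $\mathbb{P}^{\pm}=\mathbb{P}\cup(-\mathbb{P})$ be totally ordered by $-1<1<-2<2<-3<3<\cdots$. For a partial order $<_P$ on $[n]=\{1,\dots,n\}$, an enriched $P$-partition is a map $f:[n]\to\mathbb{P}^{\pm}$ such that (i) if $i<_P j$ and $i<j$ then $f(i)<f(j)$ or $f(i)=f(j)\in\mathbb{P}$; (ii) if $i<_P j$ and $i>j$ then $f(i)<f(j)$ or $f(i)=f(j)\in-\mathbb{P}$. A composition with $n$ entries is a sequence of $n$ positive integers. For $\pi\in S_n$ and a composition $\alpha$ with $n$ entries, let $<_\pi$ be the total order on $[n]$ with $\pi_i<_\pi\pi_j$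 iff $i<j$, and let $\epsilon:[n]\to\mathbb{P}$ be given by $\epsilon(\pi_i)=\alpha_i$. Define \[U^q_{\pi,\alpha}=\sum_{f}\prod_{i=1}^n q^{[f(i)<0]}x_{|f(i)|}^{\epsilon(i)},\] summing over all enriched $P$-partitions $f$ for the order $<_\pi$, where $[f(i)<0]$ is $1$ if $f(i)<0$ and $0$ otherwise, and $|f(i)|$ is the absolute value. $\operatorname{Des}(\pi)=\{1\le i\le n-1:\pi(i)>\pi(i+1)\}$ and $\operatorname{Peak}(\pi)=\{2\le i\le n-1:\pi(i-1)<\pi(i)>\pi(i+1)\}$. -}

module Defs where

open import Level using (Level)
open import Data.Nat as ℕ using (ℕ; zero; suc)
open import Data.Fin as F using (Fin; toℕ)
open import Data.Fin.Properties using (all?; any?)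
open import Data.Fin.Permutation using (Permutation′; _⟨$⟩ʳ_; _⟨$⟩ˡ_)
open import Data.List using (List; []; _∷_; map; concatMap; filter; length; foldr)
open import Data.Product using (_×_; _,_; proj₁; proj₂; ∃)
open import Data.Sum using (_⊎_)
open import Data.Vec.Functional using (Vector)
import Data.Vec.Functional as VF
open import Relation.Nullary using (Dec; yes; no)
open import Relation.Nullary.Decidable using (_×-dec_; _⊎-dec_; _→-dec_)
open import Relation.Binary.PropositionalEquality using (_≡_; refl)
open import Algebra.Bundles using (CommutativeRing)

allFuns : ∀ {a} {A : Set a} → List A → (n : ℕ) → List (Fin n → A)
allFuns xs zero    = (λ ()) ∷ []
allFuns xs (suc n) = concatMap (λ x → map (λ g → x VF.∷ g) (allFuns xs n)) xs

Σℕ : (n : ℕ) → (Fin n → ℕ) → ℕ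
Σℕ n g = foldr ℕ._+_ 0 (map g (Data.List.allFin n))

-- Signed positive integers  ℙ± , truncated to absolute values ≤ N.
-- An element (s , j) with j : Fin N stands for ±(toℕ j + 1), i.e.
-- |(s , j)| = toℕ j + 1, negative iff s ≡ neg.

data Sign : Set where
  pos neg : Sign

_≟ˢ_ : (s t : Sign) → Dec (s ≡ t)
pos ≟ˢ pos = yes refl
neg ≟ˢ neg = yes refl
pos ≟ˢ neg = no (λ ())
neg ≟ˢ pos = no (λ ())

signs : List Sign
signs = pos ∷ neg ∷ []

PM : ℕ → Set
PM N = Sign × Fin N

allPM : (N : ℕ) → List (PM N)
allPM N = concatMap (λ s → map (λ j → s , j) (Data.List.allFin N)) signs

-- the order  -1 < 1 < -2 < 2 < -3 < 3 < ⋯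
_<±_ : ∀ {N} → PM N → PM N → Set
(s , a) <± (t , b) = (a F.< b) ⊎ ((a ≡ b) × (s ≡ neg) × (t ≡ pos))

_<±?_ : ∀ {N} (u v : PM N) → Dec (u <± v)
(s , a) <±? (t , b) = (a F.<? b) ⊎-dec ((a F.≟ b) ×-dec (s ≟ˢ neg) ×-dec (t ≟ˢ pos))

_≟±_ : ∀ {N} (u v : PM N) → Dec (u ≡ v)
(s , a) ≟± (t , b) with s ≟ˢ t | a F.≟ b
... | yes refl | yes refl = yes refl
... | no ¬p    | _        = no (λ { refl → ¬p refl })
... | yes _    | no ¬q    = no (λ { refl → ¬q refl })

-- Enriched P-partitions for the total order <_π on [n] (here Fin n):
-- π_k <_π π_l iff k < l, i.e.  i <_π j  iff  π⁻¹(i) < π⁻¹(j).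

_<[_]_ : ∀ {n} → Fin n → Permutation′ n → Fin n → Set
i <[ π ] j = (π ⟨$⟩ˡ i) F.< (π ⟨$⟩ˡ j)

Enriched : ∀ {n N} → Permutation′ n → (Fin n → PM N) → Set
Enriched {n} π f = ∀ (i j : Fin n) → i <[ π ] j →
  ((i F.< j) → (f i <± f j) ⊎ ((f i ≡ f j) × (proj₁ (f i) ≡ pos)))
  × ((j F.< i) → (f i <± f j) ⊎ ((f i ≡ f j) × (proj₁ (f i) ≡ neg)))

enriched? : ∀ {n N} (π : Permutation′ n) (f : Fin n → PM N) → Dec (Enriched π f)
enriched? π f = all? λ i → all? λ j →
  ((π ⟨$⟩ˡ i) F.<? (π ⟨$⟩ˡ j)) →-dec
    (((i F.<? j) →-dec ((f i <±? f j) ⊎-dec ((f i ≟± f j) ×-dec (proj₁ (f i) ≟ˢ pos))))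
    ×-dec ((j F.<? i) →-dec ((f i <±? f j) ⊎-dec ((f i ≟± f j) ×-dec (proj₁ (f i) ≟ˢ neg)))))

-- ε(π_k) = α_k, i.e. ε(i) = α(π⁻¹ i)
ε : ∀ {n} → Permutation′ n → (Fin n → ℕ) → Fin n → ℕ
ε π α i = α (π ⟨$⟩ˡ i)

-- exponent of x_{j+1} in ∏_i x_{|f(i)|}^{ε(i)}
expU : ∀ {n N} → Permutation′ n → (Fin n → ℕ) → (Fin n → PM N) → Fin N → ℕ
expU {n} π α f j = Σℕ n (λ i → count i)
  where
  count : _ → ℕ
  count i with proj₂ (f i) F.≟ j
  ... | yes _ = ε π α i
  ... | no  _ = 0

negCount : ∀ {n N} → (Fin n → PM N) → ℕ
negCount {n} f = length (filter (λ i → proj₁ (f i) ≟ˢ neg) (Data.List.allFin n))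

-- Right-hand side: sequences i_1 ≤ ⋯ ≤ i_n with values in {1,…,N},
-- represented as s : Fin n → Fin N (s k stands for the integer toℕ (s k) + 1).
-- Positions are 0-based: position k (Fin n) is the paper's position k+1.

Next : ∀ {n} → Fin n → Fin n → Set
Next k l = toℕ l ≡ suc (toℕ k)

next? : ∀ {n} (k l : Fin n) → Dec (Next k l)
next? k l = toℕ l ℕ.≟ suc (toℕ k)

WeaklyIncr : ∀ {n N} → (Fin n → Fin N) → Set
WeaklyIncr {n} s = ∀ (k l : Fin n) → Next k l → s k F.≤ s l

weaklyIncr? : ∀ {n N} (s : Fin n → Fin N) → Dec (WeaklyIncr s)
weaklyIncr? s = all? λ k → all? λ l → next? k l →-dec (s k F.≤? s l)

PeakCond : ∀ {n N} → Permutation′ n → (Fin n → Fin N) → Set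
PeakCond {n} π s = ∀ (a b c : Fin n) → Next a b → Next b c →
  (π ⟨$⟩ʳ a) F.< (π ⟨$⟩ʳ b) → (π ⟨$⟩ʳ c) F.< (π ⟨$⟩ʳ b) → s a F.< s c

peakCond? : ∀ {n N} (π : Permutation′ n) (s : Fin n → Fin N) → Dec (PeakCond π s)
peakCond? π s = all? λ a → all? λ b → all? λ c →
  next? a b →-dec next? b c →-dec ((π ⟨$⟩ʳ a) F.<? (π ⟨$⟩ʳ b)) →-dec
  ((π ⟨$⟩ʳ c) F.<? (π ⟨$⟩ʳ b)) →-dec (s a F.<? s c)

desEqCount : ∀ {n N} → Permutation′ n → (Fin n → Fin N) → ℕ
desEqCount {n} π s = length (filter (λ k → any? λ l →
  next? k l ×-dec ((π ⟨$⟩ʳ l) F.<? (π ⟨$⟩ʳ k)) ×-dec (s k F.≟ s l))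
  (Data.List.allFin n))

distinctCount : ∀ {n N} → (Fin n → Fin N) → ℕ
distinctCount {n} {N} s = length (filter (λ j → any? λ k → s k F.≟ j) (Data.List.allFin N))

-- exponent of x_{j+1} in x_{i_1}^{α_1} ⋯ x_{i_n}^{α_n}
expR : ∀ {n N} → (Fin n → ℕ) → (Fin n → Fin N) → Fin N → ℕ
expR {n} α s j = Σℕ n count
  where
  count : _ → ℕ
  count k with s k F.≟ j
  ... | yes _ = α k
  ... | no  _ = 0

_≟ₑ_ : ∀ {N} (e e′ : Fin N → ℕ) → Dec (∀ j → e j ≡ e′ j)
e ≟ₑ e′ = all? λ j → e j ℕ.≟ e′ j

-- A monomial in x_1, x_2, … all of whose variables lie among x_1..x_N is
-- given by its exponent vector e : Fin N → ℕ  (e j = exponent of x_{j+1}).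
-- Every monomial arises this way for some N.  Since all α_k ≥ 1, only
-- terms whose indices are all ≤ N can contribute to such a monomial, so
-- the coefficients below are exactly the coefficients of the two formal
-- power series.

module Coefficients {c ℓ} (R : CommutativeRing c ℓ) where
  open CommutativeRing R

  pow : Carrier → ℕ → Carrier
  pow x zero    = 1#
  pow x (suc m) = x * pow x m

  sumR : List Carrier → Carrier
  sumR = foldr _+_ 0#

  coeffU : ∀ {n} → Carrier → Permutation′ n → (Fin n → ℕ) → (N : ℕ) → (Fin N → ℕ) → Carrier
  coeffU {n} q π α N e =
    sumR (map (λ f → pow q (negCount f))
      (filter (λ f → enriched? π f ×-dec (expU π α f ≟ₑ e)) (allFuns (allPM N) n)))

  coeffRHS : ∀ {n} → Carrier → Permutation′ n → (Fin n → ℕ) → (N : ℕ) → (Fin N → ℕ) → Carrier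
  coeffRHS {n} q π α N e =
    sumR (map (λ s → pow q (desEqCount π s) * pow (q + 1#) (distinctCount s))
      (filter (λ s → weaklyIncr? s ×-dec peakCond? π s ×-dec (expR α s ≟ₑ e))
        (allFuns (Data.List.allFin N) n)))

-- Reindex an enriched P-partition by positions, g k = f(π_k), and split g into a sign vector σ
-- and a sequence of absolute values s. The enriched condition then only constrains consecutive
-- positions: s must weakly increase, and where s_k = s_{k+1} an ascent π_k < π_{k+1} forces σ_{k+1}
-- positive while a descent forces σ_k negative. Both constraints hit one letter exactly at a peak
-- inside a run of equal values, which the peak condition excludes; otherwise each run has exactly
-- one unconstrained letter. Summing q^(number of negative signs) over the admissible σ therefore
-- gives q^|{j ∈ Des(π) : i_j = i_{j+1}}| (q + 1)^|{i_1, …, i_n}|, a sum evaluated by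
-- recursion on the first letter.

module Submission where

open import Defs
open import Data.Nat using (ℕ; _≤_)
open import Data.Fin using (Fin)
open import Data.Fin.Permutation using (Permutation′)
open import Algebra.Bundles using (CommutativeRing)

open import Data.Nat using (zero; suc)
import Data.Nat as ℕ
import Data.Nat.Properties as ℕₚ
open import Data.Fin using (zero; suc)
open import Data.Fin.Patterns using (0F; 1F; 2F)
import Data.Fin as F
import Data.Fin.Properties as Fₚ
open import Data.Fin.Properties using (any?)
import Data.Fin.Permutation as Perm
open import Data.Fin.Permutation using (_⟨$⟩ʳ_; _⟨$⟩ˡ_)
open import Data.List using (List; []; _∷_; map; concatMap; filter; length; foldr; _++_; tabulate; allFin)
import Data.List.Properties as List
open import Data.Product using (_×_; _,_; proj₁; proj₂; ∃)
open import Data.Sum using (_⊎_; inj₁; inj₂)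
open import Data.Unit using (⊤; tt)
open import Data.Empty using (⊥; ⊥-elim)
open import Data.Vec.Functional using (Vector; insertAt; zip) renaming (_∷_ to _∷ᵛ_)
open import Data.Vec.Functional.Properties using (insertAt-lookup; insertAt-punchIn)
open import Function using (_∘_; id; _⇔_; mk⇔; Equivalence; Injection)
open import Function.Properties.Inverse using (↔⇒↣)
open import Function.Definitions using (Injective)
open import Relation.Nullary using (Dec; yes; no; ¬_)
open import Relation.Nullary.Decidable using (_×-dec_; _⊎-dec_; _→-dec_)
open import Relation.Unary using (Decidable)
open import Relation.Binary using (tri<; tri≈; tri>)
open import Relation.Binary.PropositionalEquality
  using (_≡_; _≢_; _≗_; refl; sym; trans; cong; cong₂; subst; subst₂; module ≡-Reasoning)
open import Algebra.Properties.CommutativeMonoid.Sum ℕₚ.+-0-commutativeMonoid using (sum; sum-permute; sum-cong-≗)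

𝟙 : ∀ {p} {P : Set p} → Dec P → ℕ
𝟙 (yes _) = 1
𝟙 (no _)  = 0

𝟙-yes : ∀ {p} {P : Set p} (P? : Dec P) → P → 𝟙 P? ≡ 1
𝟙-yes (yes _) _  = refl
𝟙-yes (no ¬p) p = ⊥-elim (¬p p)

𝟙-no : ∀ {p} {P : Set p} (P? : Dec P) → ¬ P → 𝟙 P? ≡ 0
𝟙-no (yes p) ¬p = ⊥-elim (¬p p)
𝟙-no (no _)  _  = refl

𝟙-cong : ∀ {p q} {P : Set p} {Q : Set q} (P? : Dec P) (Q? : Dec Q) → (P → Q) → (Q → P) → 𝟙 P? ≡ 𝟙 Q?
𝟙-cong (yes _) (yes _) _ _ = refl
𝟙-cong (yes p) (no ¬q) f _ = ⊥-elim (¬q (f p))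
𝟙-cong (no ¬p) (yes q) _ g = ⊥-elim (¬p (g q))
𝟙-cong (no _)  (no _)  _ _ = refl

count : ∀ {n p} {P : Fin n → Set p} → Decidable P → ℕ
count P? = sum (λ i → 𝟙 (P? i))

count-cong : ∀ {n p q} {P : Fin n → Set p} {Q : Fin n → Set q} (P? : Decidable P) (Q? : Decidable Q) →
  (∀ i → P i → Q i) → (∀ i → Q i → P i) → count P? ≡ count Q?
count-cong P? Q? f g = sum-cong-≗ (λ i → 𝟙-cong (P? i) (Q? i) (f i) (g i))

count-none : ∀ {n p} {P : Fin n → Set p} (P? : Decidable P) → (∀ i → ¬ P i) → count P? ≡ 0
count-none {zero}  P? ¬P = refl
count-none {suc n} P? ¬P = cong₂ ℕ._+_ (𝟙-no (P? zero) (¬P zero)) (count-none (P? ∘ suc) (¬P ∘ suc))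

count-insert : ∀ {n p q} {P : Fin n → Set p} {Q : Fin n → Set q} (P? : Decidable P) (Q? : Decidable Q) (a : Fin n) →
  (∀ i → Q i → P i ⊎ i ≡ a) → (∀ i → P i ⊎ i ≡ a → Q i) → ¬ P a → count Q? ≡ suc (count P?)
count-insert P? Q? zero to from ¬Pa = begin
  𝟙 (Q? zero) ℕ.+ count (Q? ∘ suc)
    ≡⟨ cong₂ ℕ._+_ (𝟙-yes (Q? zero) (from zero (inj₂ refl)))
                   (count-cong (Q? ∘ suc) (P? ∘ suc) (λ i → notZero ∘ to (suc i)) (λ i → from (suc i) ∘ inj₁)) ⟩
  suc (count (P? ∘ suc))
    ≡⟨ cong (λ k → suc (k ℕ.+ count (P? ∘ suc))) (𝟙-no (P? zero) ¬Pa) ⟨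
  suc (count P?) ∎
  where
  open ≡-Reasoning
  notZero : ∀ {m a} {A : Set a} {i : Fin m} → A ⊎ F.suc i ≡ F.zero → A
  notZero (inj₁ x) = x
count-insert P? Q? (suc a) to from ¬Pa = begin
  𝟙 (Q? zero) ℕ.+ count (Q? ∘ suc)
    ≡⟨ cong₂ ℕ._+_ (𝟙-cong (Q? zero) (P? zero) (notZero ∘ to zero) (from zero ∘ inj₁))
                   (count-insert (P? ∘ suc) (Q? ∘ suc) a (λ i → unsuc ∘ to (suc i)) (λ i → from (suc i) ∘ resuc) ¬Pa) ⟩
  𝟙 (P? zero) ℕ.+ suc (count (P? ∘ suc))
    ≡⟨ ℕₚ.+-suc _ _ ⟩
  suc (count P?) ∎
  where
  open ≡-Reasoning
  notZero : ∀ {b} {A : Set b} → A ⊎ F.zero ≡ F.suc a → A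
  notZero (inj₁ x) = x
  unsuc : ∀ {b i} {A : Set b} → A ⊎ F.suc i ≡ F.suc a → A ⊎ i ≡ a
  unsuc (inj₁ x) = inj₁ x
  unsuc (inj₂ e) = inj₂ (Fₚ.suc-injective e)
  resuc : ∀ {b i} {A : Set b} → A ⊎ i ≡ a → A ⊎ F.suc i ≡ F.suc a
  resuc (inj₁ x) = inj₁ x
  resuc (inj₂ e) = inj₂ (cong suc e)

length-filter-tabulate : ∀ {n p} {A : Set} {P : A → Set p} (P? : Decidable P) (f : Fin n → A) →
  length (filter P? (tabulate f)) ≡ count (P? ∘ f)
length-filter-tabulate {zero}  P? f = refl
length-filter-tabulate {suc n} P? f with P? (f zero)
... | yes _ = cong suc (length-filter-tabulate P? (f ∘ suc))
... | no _  = length-filter-tabulate P? (f ∘ suc)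

length-filter-allFin : ∀ {n p} {P : Fin n → Set p} (P? : Decidable P) → length (filter P? (allFin n)) ≡ count P?
length-filter-allFin P? = length-filter-tabulate P? id

foldr-tabulate : ∀ {n} (g : Fin n → ℕ) → foldr ℕ._+_ 0 (tabulate g) ≡ sum g
foldr-tabulate {zero}  g = refl
foldr-tabulate {suc n} g = cong (g zero ℕ.+_) (foldr-tabulate (g ∘ suc))

Σℕ≡sum : ∀ {n} (g : Fin n → ℕ) → Σℕ n g ≡ sum g
Σℕ≡sum g = trans (cong (foldr ℕ._+_ 0) (List.map-tabulate id g)) (foldr-tabulate g)

module RingSums {c ℓ} (R : CommutativeRing c ℓ) where
  open CommutativeRing R renaming (refl to ≈-refl; sym to ≈-sym; trans to ≈-trans) hiding (zero)
  open Coefficients R using (sumR)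
  open import Algebra.Properties.CommutativeSemigroup +-commutativeSemigroup using (interchange)
  open import Relation.Binary.Reasoning.Setoid setoid

  infixr 8 [_]·_

  [_]·_ : ∀ {p} {P : Set p} → Dec P → Carrier → Carrier
  [ yes _ ]· v = v
  [ no _ ]·  v = 0#

  ·-yes : ∀ {p} {P : Set p} (P? : Dec P) {v} → P → [ P? ]· v ≈ v
  ·-yes (yes _) _  = ≈-refl
  ·-yes (no ¬p) p = ⊥-elim (¬p p)

  ·-no : ∀ {p} {P : Set p} (P? : Dec P) {v} → ¬ P → [ P? ]· v ≈ 0#
  ·-no (yes p) ¬p = ⊥-elim (¬p p)
  ·-no (no _)  _  = ≈-refl

  ·-cong : ∀ {p q} {P : Set p} {Q : Set q} (P? : Dec P) (Q? : Dec Q) {v w} →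
    (P → Q) → (Q → P) → v ≈ w → [ P? ]· v ≈ [ Q? ]· w
  ·-cong (yes _) (yes _) _ _ v≈w = v≈w
  ·-cong (yes p) (no ¬q) f _ _   = ⊥-elim (¬q (f p))
  ·-cong (no ¬p) (yes q) _ g _   = ⊥-elim (¬p (g q))
  ·-cong (no _)  (no _)  _ _ _   = ≈-refl

  ·-congʳ : ∀ {p} {P : Set p} (P? : Dec P) {v w} → (P → v ≈ w) → [ P? ]· v ≈ [ P? ]· w
  ·-congʳ (yes p) v≈w = v≈w p
  ·-congʳ (no _)  _   = ≈-refl

  ·-×-dec : ∀ {p q} {P : Set p} {Q : Set q} (P? : Dec P) (Q? : Dec Q) v →
    [ P? ×-dec Q? ]· v ≈ [ P? ]· [ Q? ]· v
  ·-×-dec (yes _) (yes _) v = ≈-refl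
  ·-×-dec (yes _) (no _)  v = ≈-refl
  ·-×-dec (no _)  Q?      v = ≈-refl

  ·-comm : ∀ {p q} {P : Set p} {Q : Set q} (P? : Dec P) (Q? : Dec Q) v →
    [ P? ]· [ Q? ]· v ≈ [ Q? ]· [ P? ]· v
  ·-comm (yes _) (yes _) v = ≈-refl
  ·-comm (yes _) (no _)  v = ≈-refl
  ·-comm (no _)  (yes _) v = ≈-refl
  ·-comm (no _)  (no _)  v = ≈-refl

  *-·-comm : ∀ {p} {P : Set p} (P? : Dec P) u v → u * [ P? ]· v ≈ [ P? ]· (u * v)
  *-·-comm (yes _) u v = ≈-refl
  *-·-comm (no _)  u v = zeroʳ u

  ∑ : ∀ {a} {A : Set a} → List A → (A → Carrier) → Carrier
  ∑ L h = sumR (map h L)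

  infix 5 ∑
  syntax ∑ L (λ x → e) = ∑[ x ∈ L ] e

  ∑-cong : ∀ {a} {A : Set a} (L : List A) {h k : A → Carrier} → (∀ x → h x ≈ k x) → ∑ L h ≈ ∑ L k
  ∑-cong []      h≈k = ≈-refl
  ∑-cong (x ∷ L) h≈k = +-cong (h≈k x) (∑-cong L h≈k)

  ∑-++ : ∀ {a} {A : Set a} (L M : List A) (h : A → Carrier) → ∑ (L ++ M) h ≈ ∑ L h + ∑ M h
  ∑-++ []      M h = ≈-sym (+-identityˡ _)
  ∑-++ (x ∷ L) M h = ≈-trans (+-congˡ (∑-++ L M h)) (≈-sym (+-assoc _ _ _))

  ∑-map : ∀ {a b} {A : Set a} {B : Set b} (g : A → B) (L : List A) (h : B → Carrier) →
    ∑ (map g L) h ≈ ∑ L (h ∘ g)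
  ∑-map g []      h = ≈-refl
  ∑-map g (x ∷ L) h = +-congˡ (∑-map g L h)

  ∑-concatMap : ∀ {a b} {A : Set a} {B : Set b} (f : A → List B) (L : List A) (h : B → Carrier) →
    ∑ (concatMap f L) h ≈ ∑[ x ∈ L ] ∑ (f x) h
  ∑-concatMap f []      h = ≈-refl
  ∑-concatMap f (x ∷ L) h = ≈-trans (∑-++ (f x) (concatMap f L) h) (+-congˡ (∑-concatMap f L h))

  ∑-filter : ∀ {a p} {A : Set a} {P : A → Set p} (P? : Decidable P) (L : List A) (h : A → Carrier) →
    ∑ (filter P? L) h ≈ ∑[ x ∈ L ] [ P? x ]· h x
  ∑-filter P? []      h = ≈-refl
  ∑-filter P? (x ∷ L) h with P? x
  ... | yes _ = +-congˡ (∑-filter P? L h)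
  ... | no _  = ≈-trans (∑-filter P? L h) (≈-sym (+-identityˡ _))

  ∑-zero : ∀ {a} {A : Set a} (L : List A) → ∑[ x ∈ L ] 0# ≈ 0#
  ∑-zero []      = ≈-refl
  ∑-zero (x ∷ L) = ≈-trans (+-identityˡ _) (∑-zero L)

  ∑-+ : ∀ {a} {A : Set a} (L : List A) (h k : A → Carrier) → ∑[ x ∈ L ] (h x + k x) ≈ ∑ L h + ∑ L k
  ∑-+ []      h k = ≈-sym (+-identityˡ 0#)
  ∑-+ (x ∷ L) h k = ≈-trans (+-congˡ (∑-+ L h k)) (interchange _ _ _ _)

  ∑-*ˡ : ∀ {a} {A : Set a} (L : List A) u (h : A → Carrier) → ∑[ x ∈ L ] (u * h x) ≈ u * ∑ L h
  ∑-*ˡ []      u h = ≈-sym (zeroʳ u)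
  ∑-*ˡ (x ∷ L) u h = ≈-trans (+-congˡ (∑-*ˡ L u h)) (≈-sym (distribˡ u _ _))

  ∑-· : ∀ {a p} {A : Set a} {P : Set p} (L : List A) (P? : Dec P) (h : A → Carrier) →
    ∑[ x ∈ L ] [ P? ]· h x ≈ [ P? ]· ∑ L h
  ∑-· L (yes _) h = ≈-refl
  ∑-· L (no _)  h = ∑-zero L

  ∑-comm : ∀ {a b} {A : Set a} {B : Set b} (L : List A) (M : List B) (h : A → B → Carrier) →
    ∑[ x ∈ L ] ∑[ y ∈ M ] h x y ≈ ∑[ y ∈ M ] ∑[ x ∈ L ] h x y
  ∑-comm []      M h = ≈-sym (∑-zero M)
  ∑-comm (x ∷ L) M h = ≈-trans (+-congˡ (∑-comm L M h)) (≈-sym (∑-+ M (h x) _))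

  Extensional : ∀ {a n} {A : Set a} → (Vector A n → Carrier) → Set _
  Extensional h = ∀ {f g} → f ≗ g → h f ≈ h g

  ∷ᵛ-cong : ∀ {a n} {A : Set a} (x : A) {f g : Vector A n} → f ≗ g → (x ∷ᵛ f) ≗ (x ∷ᵛ g)
  ∷ᵛ-cong x f≗g zero    = refl
  ∷ᵛ-cong x f≗g (suc j) = f≗g j

  ∑-allFuns-suc : ∀ {a} {A : Set a} (xs : List A) n (h : Vector A (suc n) → Carrier) →
    ∑ (allFuns xs (suc n)) h ≈ ∑[ x ∈ xs ] ∑[ g ∈ allFuns xs n ] h (x ∷ᵛ g)
  ∑-allFuns-suc xs n h = ≈-trans (∑-concatMap _ xs h) (∑-cong xs (λ x → ∑-map (x ∷ᵛ_) (allFuns xs n) h))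

  ∑-allFuns-insertAt : ∀ {a} {A : Set a} (xs : List A) n (i : Fin (suc n)) {h : Vector A (suc n) → Carrier} →
    Extensional h → ∑ (allFuns xs (suc n)) h ≈ ∑[ x ∈ xs ] ∑[ g ∈ allFuns xs n ] h (insertAt g i x)
  ∑-allFuns-insertAt xs n       zero    {h} ext = ≈-trans (∑-allFuns-suc xs n h)
    (∑-cong xs λ x → ∑-cong (allFuns xs n) λ g → ext λ { zero → refl ; (suc j) → refl })
  ∑-allFuns-insertAt xs (suc n) (suc i) {h} ext = begin
    ∑ (allFuns xs (suc (suc n))) h
      ≈⟨ ∑-allFuns-suc xs (suc n) h ⟩
    ∑[ y ∈ xs ] ∑[ g ∈ allFuns xs (suc n) ] h (y ∷ᵛ g)
      ≈⟨ ∑-cong xs (λ y → ∑-allFuns-insertAt xs n i (ext ∘ ∷ᵛ-cong y)) ⟩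
    ∑[ y ∈ xs ] ∑[ x ∈ xs ] ∑[ g ∈ allFuns xs n ] h (y ∷ᵛ insertAt g i x)
      ≈⟨ ∑-comm xs xs _ ⟩
    ∑[ x ∈ xs ] ∑[ y ∈ xs ] ∑[ g ∈ allFuns xs n ] h (y ∷ᵛ insertAt g i x)
      ≈⟨ ∑-cong xs (λ x → ∑-cong xs λ y → ∑-cong (allFuns xs n) λ g → ext λ { zero → refl ; (suc j) → refl }) ⟩
    ∑[ x ∈ xs ] ∑[ y ∈ xs ] ∑[ g ∈ allFuns xs n ] h (insertAt (y ∷ᵛ g) (suc i) x)
      ≈⟨ ∑-cong xs (λ x → ≈-sym (∑-allFuns-suc xs n (λ g → h (insertAt g (suc i) x)))) ⟩
    ∑[ x ∈ xs ] ∑[ g ∈ allFuns xs (suc n) ] h (insertAt g (suc i) x) ∎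

  ∑-allFuns-permute : ∀ {a} {A : Set a} (xs : List A) n (ρ : Permutation′ n) {h : Vector A n → Carrier} →
    Extensional h → ∑[ f ∈ allFuns xs n ] h (f ∘ (ρ ⟨$⟩ʳ_)) ≈ ∑ (allFuns xs n) h
  ∑-allFuns-permute xs zero    ρ ext = +-congʳ (ext λ ())
  ∑-allFuns-permute xs (suc n) ρ {h} ext = begin
    ∑[ f ∈ allFuns xs (suc n) ] h (f ∘ (ρ ⟨$⟩ʳ_))
      ≈⟨ ∑-allFuns-insertAt xs n (ρ ⟨$⟩ʳ zero) (λ f≗g → ext (f≗g ∘ (ρ ⟨$⟩ʳ_))) ⟩
    ∑[ x ∈ xs ] ∑[ g ∈ allFuns xs n ] h (insertAt g (ρ ⟨$⟩ʳ zero) x ∘ (ρ ⟨$⟩ʳ_))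
      ≈⟨ ∑-cong xs (λ x → ∑-cong (allFuns xs n) (λ g → ext (insertAt-permute g x))) ⟩
    ∑[ x ∈ xs ] ∑[ g ∈ allFuns xs n ] h (x ∷ᵛ (g ∘ (ρ′ ⟨$⟩ʳ_)))
      ≈⟨ ∑-cong xs (λ x → ∑-allFuns-permute xs n ρ′ (ext ∘ ∷ᵛ-cong x)) ⟩
    ∑[ x ∈ xs ] ∑[ g ∈ allFuns xs n ] h (x ∷ᵛ g)
      ≈⟨ ≈-sym (∑-allFuns-suc xs n h) ⟩
    ∑ (allFuns xs (suc n)) h ∎
    where
    ρ′ = Perm.remove zero ρ
    insertAt-permute : ∀ g x → insertAt g (ρ ⟨$⟩ʳ zero) x ∘ (ρ ⟨$⟩ʳ_) ≗ x ∷ᵛ (g ∘ (ρ′ ⟨$⟩ʳ_))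
    insertAt-permute g x zero    = insertAt-lookup g (ρ ⟨$⟩ʳ zero) x
    insertAt-permute g x (suc j) = trans (cong (λ k → insertAt g (ρ ⟨$⟩ʳ zero) x k) (Perm.punchIn-permute ρ zero j))
                                         (insertAt-punchIn g (ρ ⟨$⟩ʳ zero) x _)

  ∑-allFuns-zip : ∀ {a b} {A : Set a} {B : Set b} (xs : List A) (ys : List B) n {h : Vector (A × B) n → Carrier} →
    Extensional h →
    ∑ (allFuns (concatMap (λ x → map (x ,_) ys) xs) n) h ≈ ∑[ t ∈ allFuns ys n ] ∑[ σ ∈ allFuns xs n ] h (zip σ t)
  ∑-allFuns-zip xs ys zero    ext = +-congʳ (≈-trans (ext λ ()) (≈-sym (+-identityʳ _)))
  ∑-allFuns-zip xs ys (suc n) {h} ext = begin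
    ∑ (allFuns xys (suc n)) h
      ≈⟨ ∑-allFuns-suc xys n h ⟩
    ∑[ z ∈ xys ] ∑[ g ∈ allFuns xys n ] h (z ∷ᵛ g)
      ≈⟨ ∑-concatMap _ xs _ ⟩
    ∑[ x ∈ xs ] ∑ (map (x ,_) ys) (λ z → ∑[ g ∈ allFuns xys n ] h (z ∷ᵛ g))
      ≈⟨ ∑-cong xs (λ x → ∑-map (x ,_) ys _) ⟩
    ∑[ x ∈ xs ] ∑[ y ∈ ys ] ∑[ g ∈ allFuns xys n ] h ((x , y) ∷ᵛ g)
      ≈⟨ ∑-cong xs (λ x → ∑-cong ys (λ y → ∑-allFuns-zip xs ys n (ext ∘ ∷ᵛ-cong (x , y)))) ⟩
    ∑[ x ∈ xs ] ∑[ y ∈ ys ] ∑[ t ∈ allFuns ys n ] ∑[ σ ∈ allFuns xs n ] h ((x , y) ∷ᵛ zip σ t)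
      ≈⟨ ∑-cong xs (λ x → ∑-cong ys λ y → ∑-cong (allFuns ys n) λ t → ∑-cong (allFuns xs n) λ σ →
           ext λ { zero → refl ; (suc j) → refl }) ⟩
    ∑[ x ∈ xs ] ∑[ y ∈ ys ] ∑[ t ∈ allFuns ys n ] ∑[ σ ∈ allFuns xs n ] h (zip (x ∷ᵛ σ) (y ∷ᵛ t))
      ≈⟨ ∑-comm xs ys _ ⟩
    ∑[ y ∈ ys ] ∑[ x ∈ xs ] ∑[ t ∈ allFuns ys n ] ∑[ σ ∈ allFuns xs n ] h (zip (x ∷ᵛ σ) (y ∷ᵛ t))
      ≈⟨ ∑-cong ys (λ y → ∑-comm xs (allFuns ys n) _) ⟩
    ∑[ y ∈ ys ] ∑[ t ∈ allFuns ys n ] ∑[ x ∈ xs ] ∑[ σ ∈ allFuns xs n ] h (zip (x ∷ᵛ σ) (y ∷ᵛ t))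
      ≈⟨ ∑-cong ys (λ y → ∑-cong (allFuns ys n) (λ t → ≈-sym (∑-allFuns-suc xs n (λ σ → h (zip σ (y ∷ᵛ t)))))) ⟩
    ∑[ y ∈ ys ] ∑[ t ∈ allFuns ys n ] ∑[ σ ∈ allFuns xs (suc n) ] h (zip σ (y ∷ᵛ t))
      ≈⟨ ≈-sym (∑-allFuns-suc ys n _) ⟩
    ∑[ t ∈ allFuns ys (suc n) ] ∑[ σ ∈ allFuns xs (suc n) ] h (zip σ t) ∎
    where
    xys = concatMap (λ x → map (x ,_) ys) xs

private
  variable
    n m N : ℕ

_≼⁺_ _≼⁻_ : PM N → PM N → Set
u ≼⁺ v = (u <± v) ⊎ (u ≡ v × proj₁ u ≡ pos)
u ≼⁻ v = (u <± v) ⊎ (u ≡ v × proj₁ u ≡ neg)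

EnrichedPair : Fin m → Fin m → PM N → PM N → Set
EnrichedPair a b u v = (a F.< b → u ≼⁺ v) × (b F.< a → u ≼⁻ v)

enrichedPair? : (a b : Fin m) (u v : PM N) → Dec (EnrichedPair a b u v)
enrichedPair? a b u v =
  (a F.<? b →-dec ((u <±? v) ⊎-dec ((u ≟± v) ×-dec (proj₁ u ≟ˢ pos)))) ×-dec
  (b F.<? a →-dec ((u <±? v) ⊎-dec ((u ≟± v) ×-dec (proj₁ u ≟ˢ neg))))

<±-trans : {u v w : PM N} → u <± v → v <± w → u <± w
<±-trans (inj₁ a<b)             (inj₁ b<c)             = inj₁ (Fₚ.<-trans a<b b<c)
<±-trans (inj₁ a<b)             (inj₂ (refl , _ , _))  = inj₁ a<b
<±-trans (inj₂ (refl , _ , _))  (inj₁ b<c)             = inj₁ b<c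
<±-trans (inj₂ (refl , _ , refl)) (inj₂ (refl , () , _))

≼⁺-trans : {u v w : PM N} → u ≼⁺ v → v ≼⁺ w → u ≼⁺ w
≼⁺-trans (inj₁ u<v)        (inj₁ v<w)        = inj₁ (<±-trans u<v v<w)
≼⁺-trans (inj₁ u<v)        (inj₂ (refl , _)) = inj₁ u<v
≼⁺-trans (inj₂ (refl , _)) v≼w               = v≼w

≼⁻-trans : {u v w : PM N} → u ≼⁻ v → v ≼⁻ w → u ≼⁻ w
≼⁻-trans (inj₁ u<v)        (inj₁ v<w)        = inj₁ (<±-trans u<v v<w)
≼⁻-trans (inj₁ u<v)        (inj₂ (refl , _)) = inj₁ u<v
≼⁻-trans (inj₂ (refl , _)) v≼w               = v≼w

≼⁺-≼⁻-trans : {u v w : PM N} → u ≼⁺ v → v ≼⁻ w → u <± w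
≼⁺-≼⁻-trans (inj₁ u<v)           (inj₁ v<w)           = <±-trans u<v v<w
≼⁺-≼⁻-trans (inj₁ u<v)           (inj₂ (refl , _))    = u<v
≼⁺-≼⁻-trans (inj₂ (refl , _))    (inj₁ v<w)           = v<w
≼⁺-≼⁻-trans (inj₂ (refl , refl)) (inj₂ (refl , ()))

≼⁻-≼⁺-trans : {u v w : PM N} → u ≼⁻ v → v ≼⁺ w → u <± w
≼⁻-≼⁺-trans (inj₁ u<v)           (inj₁ v<w)           = <±-trans u<v v<w
≼⁻-≼⁺-trans (inj₁ u<v)           (inj₂ (refl , _))    = u<v
≼⁻-≼⁺-trans (inj₂ (refl , _))    (inj₁ v<w)           = v<w
≼⁻-≼⁺-trans (inj₂ (refl , refl)) (inj₂ (refl , ()))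

≢⇒<⊎> : {a b : Fin m} → a ≢ b → a F.< b ⊎ b F.< a
≢⇒<⊎> {a = a} {b} a≢b with Fₚ.<-cmp a b
... | tri< a<b _ _ = inj₁ a<b
... | tri≈ _ a≡b _ = ⊥-elim (a≢b a≡b)
... | tri> _ _ b<a = inj₂ b<a

EnrichedPair-trans : {a b c : Fin m} {u v w : PM N} → a ≢ b → b ≢ c →
  EnrichedPair a b u v → EnrichedPair b c v w → EnrichedPair a c u w
EnrichedPair-trans a≢b b≢c (uv⁺ , uv⁻) (vw⁺ , vw⁻) with ≢⇒<⊎> a≢b | ≢⇒<⊎> b≢c
... | inj₁ a<b | inj₁ b<c = (λ _ → ≼⁺-trans (uv⁺ a<b) (vw⁺ b<c))
                          , (λ c<a → ⊥-elim (Fₚ.<-asym (Fₚ.<-trans a<b b<c) c<a))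
... | inj₁ a<b | inj₂ c<b = (λ _ → inj₁ (≼⁺-≼⁻-trans (uv⁺ a<b) (vw⁻ c<b)))
                          , (λ _ → inj₁ (≼⁺-≼⁻-trans (uv⁺ a<b) (vw⁻ c<b)))
... | inj₂ b<a | inj₁ b<c = (λ _ → inj₁ (≼⁻-≼⁺-trans (uv⁻ b<a) (vw⁺ b<c)))
                          , (λ _ → inj₁ (≼⁻-≼⁺-trans (uv⁻ b<a) (vw⁺ b<c)))
... | inj₂ b<a | inj₂ c<b = (λ a<c → ⊥-elim (Fₚ.<-asym (Fₚ.<-trans c<b b<a) a<c))
                          , (λ _ → ≼⁻-trans (uv⁻ b<a) (vw⁻ c<b))

-- Conditions on words indexed by positions: p k plays the role of π_k and g k of f(π_k). The
-- labelling p is an arbitrary injection because the recursion drops the first position.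
EnrichedChain : (Fin n → Fin m) → (Fin n → PM N) → Set
EnrichedChain {zero}        p g = ⊤
EnrichedChain {suc zero}    p g = ⊤
EnrichedChain {suc (suc n)} p g =
  EnrichedPair (p 0F) (p 1F) (g 0F) (g 1F) × EnrichedChain (p ∘ suc) (g ∘ suc)

enrichedChain? : (p : Fin n → Fin m) (g : Fin n → PM N) → Dec (EnrichedChain p g)
enrichedChain? {zero}        p g = yes tt
enrichedChain? {suc zero}    p g = yes tt
enrichedChain? {suc (suc n)} p g =
  enrichedPair? (p 0F) (p 1F) (g 0F) (g 1F) ×-dec enrichedChain? (p ∘ suc) (g ∘ suc)

EnrichedAlong : (Fin n → Fin m) → (Fin n → PM N) → Set
EnrichedAlong p g = ∀ k l → k F.< l → EnrichedPair (p k) (p l) (g k) (g l)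

along⇒chain : (p : Fin n → Fin m) (g : Fin n → PM N) → EnrichedAlong p g → EnrichedChain p g
along⇒chain {zero}        p g _     = tt
along⇒chain {suc zero}    p g _     = tt
along⇒chain {suc (suc n)} p g along =
  along 0F 1F (ℕ.s≤s ℕ.z≤n) ,
  along⇒chain (p ∘ suc) (g ∘ suc) (λ k l k<l → along (suc k) (suc l) (ℕ.s≤s k<l))

chain⇒along : (p : Fin n → Fin m) (g : Fin n → PM N) → Injective _≡_ _≡_ p → EnrichedChain p g → EnrichedAlong p g
chain⇒along {suc (suc n)} p g inj (g₀₁ , _) 0F 1F _ = g₀₁
chain⇒along {suc (suc n)} p g inj (g₀₁ , chain) 0F (suc (suc l)) _ =
  EnrichedPair-trans (Fₚ.0≢1+n ∘ inj) (Fₚ.0≢1+n ∘ Fₚ.suc-injective ∘ inj) g₀₁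
    (chain⇒along (p ∘ suc) (g ∘ suc) (Fₚ.suc-injective ∘ inj) chain zero (suc l) (ℕ.s≤s ℕ.z≤n))
chain⇒along {suc (suc n)} p g inj (_ , chain) (suc k) (suc l) (ℕ.s≤s k<l) =
  chain⇒along (p ∘ suc) (g ∘ suc) (Fₚ.suc-injective ∘ inj) chain k l k<l

enriched⇔along : (π : Permutation′ n) (g : Fin n → PM N) →
  Enriched π (g ∘ (π ⟨$⟩ˡ_)) ⇔ EnrichedAlong (π ⟨$⟩ʳ_) g
enriched⇔along π g = mk⇔
  (λ enr k l k<l → subst₂ (λ k′ l′ → EnrichedPair (π ⟨$⟩ʳ k) (π ⟨$⟩ʳ l) (g k′) (g l′)) (Perm.inverseˡ π) (Perm.inverseˡ π)
     (enr (π ⟨$⟩ʳ k) (π ⟨$⟩ʳ l) (subst₂ F._<_ (sym (Perm.inverseˡ π)) (sym (Perm.inverseˡ π)) k<l)))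
  (λ along i j i<j → subst₂ (λ i′ j′ → EnrichedPair i′ j′ (g (π ⟨$⟩ˡ i)) (g (π ⟨$⟩ˡ j))) (Perm.inverseʳ π) (Perm.inverseʳ π)
     (along (π ⟨$⟩ˡ i) (π ⟨$⟩ˡ j) i<j))

enriched⇔chain : (π : Permutation′ n) (g : Fin n → PM N) → Enriched π (g ∘ (π ⟨$⟩ˡ_)) ⇔ EnrichedChain (π ⟨$⟩ʳ_) g
enriched⇔chain π g = mk⇔
  (along⇒chain (π ⟨$⟩ʳ_) g ∘ Equivalence.to (enriched⇔along π g))
  (Equivalence.from (enriched⇔along π g) ∘ chain⇒along (π ⟨$⟩ʳ_) g (Injection.injective (↔⇒↣ π)))

<±⇒≤ : {u v : PM N} → u <± v → proj₂ u F.≤ proj₂ v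
<±⇒≤ (inj₁ a<b)            = ℕₚ.<⇒≤ a<b
<±⇒≤ (inj₂ (refl , _ , _)) = Fₚ.≤-refl

≼⁺⇒≤ : {u v : PM N} → u ≼⁺ v → proj₂ u F.≤ proj₂ v
≼⁺⇒≤ (inj₁ u<v)        = <±⇒≤ u<v
≼⁺⇒≤ (inj₂ (refl , _)) = Fₚ.≤-refl

≼⁻⇒≤ : {u v : PM N} → u ≼⁻ v → proj₂ u F.≤ proj₂ v
≼⁻⇒≤ (inj₁ u<v)        = <±⇒≤ u<v
≼⁻⇒≤ (inj₂ (refl , _)) = Fₚ.≤-refl

pair-jump : {a b : Fin m} {x y : Sign} {i j : Fin N} → i F.< j → EnrichedPair a b (x , i) (y , j)
pair-jump i<j = (λ _ → inj₁ (inj₁ i<j)) , (λ _ → inj₁ (inj₁ i<j))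

pair-drop : {a b : Fin m} {x y : Sign} {i j : Fin N} → a ≢ b → j F.< i → ¬ EnrichedPair a b (x , i) (y , j)
pair-drop a≢b j<i (⁺ , ⁻) with ≢⇒<⊎> a≢b
... | inj₁ a<b = ℕₚ.<⇒≱ j<i (≼⁺⇒≤ (⁺ a<b))
... | inj₂ b<a = ℕₚ.<⇒≱ j<i (≼⁻⇒≤ (⁻ b<a))

pair-tie-ascent : {a b : Fin m} {x y : Sign} {i j : Fin N} → i ≡ j → a F.< b →
  EnrichedPair a b (x , i) (y , j) ⇔ y ≡ pos
pair-tie-ascent {x = x} refl a<b =
  mk⇔ (λ (⁺ , _) → to (⁺ a<b)) (λ y≡pos → (λ _ → from x y≡pos) , (λ b<a → ⊥-elim (Fₚ.<-asym a<b b<a)))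
  where
  to : ∀ {x y j} → (x , j) ≼⁺ (y , j) → y ≡ pos
  to (inj₁ (inj₁ j<j))            = ⊥-elim (Fₚ.<-irrefl refl j<j)
  to (inj₁ (inj₂ (_ , _ , y≡pos))) = y≡pos
  to (inj₂ (refl , x≡pos))         = x≡pos
  from : ∀ x {y j} → y ≡ pos → (x , j) ≼⁺ (y , j)
  from pos refl = inj₂ (refl , refl)
  from neg refl = inj₁ (inj₂ (refl , refl , refl))

pair-tie-descent : {a b : Fin m} {x y : Sign} {i j : Fin N} → i ≡ j → b F.< a →
  EnrichedPair a b (x , i) (y , j) ⇔ x ≡ neg
pair-tie-descent {y = y} refl b<a =
  mk⇔ (λ (_ , ⁻) → to (⁻ b<a)) (λ x≡neg → (λ a<b → ⊥-elim (Fₚ.<-asym a<b b<a)) , (λ _ → from y x≡neg))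
  where
  to : ∀ {x y j} → (x , j) ≼⁻ (y , j) → x ≡ neg
  to (inj₁ (inj₁ j<j))            = ⊥-elim (Fₚ.<-irrefl refl j<j)
  to (inj₁ (inj₂ (_ , x≡neg , _))) = x≡neg
  to (inj₂ (refl , x≡neg))         = x≡neg
  from : ∀ y {x j} → x ≡ neg → (x , j) ≼⁻ (y , j)
  from pos refl = inj₁ (inj₂ (refl , refl , refl))
  from neg refl = inj₂ (refl , refl)

PeakCond₁ : (Fin (suc (suc n)) → Fin m) → (Fin (suc (suc n)) → Fin N) → Set
PeakCond₁ {zero}  p s = ⊤
PeakCond₁ {suc n} p s = p 0F F.< p 1F → p 2F F.< p 1F → s 0F F.< s 2F

peakCond₁? : (p : Fin (suc (suc n)) → Fin m) (s : Fin (suc (suc n)) → Fin N) → Dec (PeakCond₁ p s)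
peakCond₁? {zero}  p s = yes tt
peakCond₁? {suc n} p s = p 0F F.<? p 1F →-dec (p 2F F.<? p 1F →-dec s 0F F.<? s 2F)

Admissible : (Fin n → Fin m) → (Fin n → Fin N) → Set
Admissible {zero}        p s = ⊤
Admissible {suc zero}    p s = ⊤
Admissible {suc (suc n)} p s = s 0F F.≤ s 1F × PeakCond₁ p s × Admissible (p ∘ suc) (s ∘ suc)

admissible? : (p : Fin n → Fin m) (s : Fin n → Fin N) → Dec (Admissible p s)
admissible? {zero}        p s = yes tt
admissible? {suc zero}    p s = yes tt
admissible? {suc (suc n)} p s = s 0F F.≤? s 1F ×-dec peakCond₁? p s ×-dec admissible? (p ∘ suc) (s ∘ suc)

weaklyIncr-tail : {s : Fin (suc n) → Fin N} → WeaklyIncr s → WeaklyIncr (s ∘ suc)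
weaklyIncr-tail incr k l k→l = incr (suc k) (suc l) (cong suc k→l)

PeaksSeparated : (Fin n → Fin m) → (Fin n → Fin N) → Set
PeaksSeparated {n} p s = ∀ (a b c : Fin n) → Next a b → Next b c → p a F.< p b → p c F.< p b → s a F.< s c

admissible⇒weaklyIncr : (p : Fin n → Fin m) (s : Fin n → Fin N) → Admissible p s → WeaklyIncr s
admissible⇒weaklyIncr {suc zero}    p s _ 0F 0F ()
admissible⇒weaklyIncr {suc (suc n)} p s (s₀≤s₁ , _) 0F 1F _ = s₀≤s₁
admissible⇒weaklyIncr {suc (suc n)} p s _ 0F 0F ()
admissible⇒weaklyIncr {suc (suc n)} p s _ 0F (suc (suc l)) ()
admissible⇒weaklyIncr {suc (suc n)} p s _ (suc k) 0F ()
admissible⇒weaklyIncr {suc (suc n)} p s (_ , _ , adm) (suc k) (suc l) k→l =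
  admissible⇒weaklyIncr (p ∘ suc) (s ∘ suc) adm k l (ℕₚ.suc-injective k→l)

admissible⇒peaksSeparated : (p : Fin n → Fin m) (s : Fin n → Fin N) → Admissible p s → PeaksSeparated p s
admissible⇒peaksSeparated {suc zero}          p s _ 0F 0F _ ()
admissible⇒peaksSeparated {suc (suc (suc n))} p s (_ , peak , _) 0F 1F 2F _ _ = peak
admissible⇒peaksSeparated {suc (suc n)}       p s _ 0F 1F 0F _ ()
admissible⇒peaksSeparated {suc (suc n)}       p s _ 0F 1F 1F _ ()
admissible⇒peaksSeparated {suc (suc (suc n))} p s _ 0F 1F (suc (suc (suc c))) _ ()
admissible⇒peaksSeparated {suc (suc n)}       p s _ 0F 0F _ ()
admissible⇒peaksSeparated {suc (suc n)}       p s _ 0F (suc (suc b)) _ ()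
admissible⇒peaksSeparated {suc (suc n)}       p s _ (suc a) 0F _ ()
admissible⇒peaksSeparated {suc (suc n)}       p s _ (suc a) (suc b) 0F _ ()
admissible⇒peaksSeparated {suc (suc n)}       p s (_ , _ , adm) (suc a) (suc b) (suc c) a→b b→c =
  admissible⇒peaksSeparated (p ∘ suc) (s ∘ suc) adm a b c (ℕₚ.suc-injective a→b) (ℕₚ.suc-injective b→c)

weaklyIncr∧peaksSeparated⇒admissible : (p : Fin n → Fin m) (s : Fin n → Fin N) →
  WeaklyIncr s → PeaksSeparated p s → Admissible p s
weaklyIncr∧peaksSeparated⇒admissible {zero}        p s _ _ = tt
weaklyIncr∧peaksSeparated⇒admissible {suc zero}    p s _ _ = tt
weaklyIncr∧peaksSeparated⇒admissible {suc (suc n)} p s incr peaks =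
  incr 0F 1F refl , peak n p s peaks ,
  weaklyIncr∧peaksSeparated⇒admissible (p ∘ suc) (s ∘ suc)
    (weaklyIncr-tail incr)
    (λ a b c a→b b→c → peaks (suc a) (suc b) (suc c) (cong suc a→b) (cong suc b→c))
  where
  peak : ∀ n (p : Fin (suc (suc n)) → Fin m) (s : Fin (suc (suc n)) → Fin N) → PeaksSeparated p s → PeakCond₁ p s
  peak zero    p s peaks = tt
  peak (suc n) p s peaks = peaks 0F 1F 2F refl refl

descentTie? : (p : Fin (suc (suc n)) → Fin m) (s : Fin (suc (suc n)) → Fin N) → Dec (p 1F F.< p 0F × s 0F ≡ s 1F)
descentTie? p s = p 1F F.<? p 0F ×-dec s 0F F.≟ s 1F

equalDescents : (Fin n → Fin m) → (Fin n → Fin N) → ℕ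
equalDescents {zero}        p s = 0
equalDescents {suc zero}    p s = 0
equalDescents {suc (suc n)} p s = 𝟙 (descentTie? p s) ℕ.+ equalDescents (p ∘ suc) (s ∘ suc)

jumps : (Fin n → Fin N) → ℕ
jumps {zero}        s = 0
jumps {suc zero}    s = 0
jumps {suc (suc n)} s = 𝟙 (s 0F F.<? s 1F) ℕ.+ jumps (s ∘ suc)

EqualDescentAt : (Fin n → Fin m) → (Fin n → Fin N) → Fin n → Set
EqualDescentAt p s k = ∃ λ l → Next k l × p l F.< p k × s k ≡ s l

equalDescentAt? : (p : Fin n → Fin m) (s : Fin n → Fin N) → Decidable (EqualDescentAt p s)
equalDescentAt? p s k = any? λ l → next? k l ×-dec (p l F.<? p k) ×-dec (s k F.≟ s l)

count-equalDescentAt : (p : Fin n → Fin m) (s : Fin n → Fin N) → count (equalDescentAt? p s) ≡ equalDescents p s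
count-equalDescentAt {zero}        p s = refl
count-equalDescentAt {suc zero}    p s = cong (ℕ._+ 0) (𝟙-no (equalDescentAt? p s 0F) λ { (0F , () , _) })
count-equalDescentAt {suc (suc n)} p s = cong₂ ℕ._+_
  (𝟙-cong (equalDescentAt? p s 0F) (descentTie? p s)
     (λ { (1F , _ , d) → d ; (0F , () , _) ; (suc (suc l) , () , _) }) (λ d → 1F , refl , d))
  (trans (count-cong (equalDescentAt? p s ∘ suc) (equalDescentAt? (p ∘ suc) (s ∘ suc))
            (λ { k (0F , () , _) ; k (suc l , k→l , d) → l , ℕₚ.suc-injective k→l , d })
            (λ { k (l , k→l , d) → suc l , cong suc k→l , d }))
         (count-equalDescentAt (p ∘ suc) (s ∘ suc)))

Taken : (Fin n → Fin N) → Fin N → Set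
Taken s j = ∃ λ k → s k ≡ j

taken? : (s : Fin n → Fin N) → Decidable (Taken s)
taken? s j = any? λ k → s k F.≟ j

weaklyIncr-min : {s : Fin (suc n) → Fin N} → WeaklyIncr s → ∀ k → s 0F F.≤ s k
weaklyIncr-min {zero}  incr 0F      = Fₚ.≤-refl
weaklyIncr-min {suc n} incr 0F      = Fₚ.≤-refl
weaklyIncr-min {suc n} incr (suc k) = Fₚ.≤-trans (incr 0F 1F refl) (weaklyIncr-min (weaklyIncr-tail incr) k)

count-taken-weaklyIncr : (s : Fin (suc n) → Fin N) → WeaklyIncr s →
  count (taken? s) ≡ suc (jumps s)
count-taken-weaklyIncr {zero} {N} s incr =
  trans (count-insert {P = λ _ → ⊥} (λ _ → no λ ()) (taken? s) (s 0F)
           (λ { j (0F , e) → inj₂ (sym e) }) (λ { j (inj₂ e) → 0F , sym e }) λ ())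
        (cong suc (count-none {P = λ (_ : Fin N) → ⊥} (λ _ → no λ ()) λ _ ()))
count-taken-weaklyIncr {suc n} s incr with Fₚ.<-cmp (s 0F) (s 1F)
... | tri< s₀<s₁ _ _ = begin
  count (taken? s)
    ≡⟨ count-insert (taken? (s ∘ suc)) (taken? s) (s 0F)
         (λ { j (0F , e) → inj₂ (sym e) ; j (suc k , e) → inj₁ (k , e) })
         (λ { j (inj₁ (k , e)) → suc k , e ; j (inj₂ e) → 0F , sym e })
         (λ (k , e) → Fₚ.<-irrefl (sym e) (ℕₚ.<-≤-trans s₀<s₁ (weaklyIncr-min (weaklyIncr-tail incr) k))) ⟩
  suc (count (taken? (s ∘ suc)))
    ≡⟨ cong suc (count-taken-weaklyIncr (s ∘ suc) (weaklyIncr-tail incr)) ⟩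
  suc (suc (jumps (s ∘ suc)))
    ≡⟨ cong (λ b → suc (b ℕ.+ jumps (s ∘ suc))) (𝟙-yes (s 0F F.<? s 1F) s₀<s₁) ⟨
  suc (jumps s) ∎
  where open ≡-Reasoning
... | tri≈ _ s₀≡s₁ _ = begin
  count (taken? s)
    ≡⟨ count-cong (taken? s) (taken? (s ∘ suc))
         (λ { j (0F , e) → 0F , trans (sym s₀≡s₁) e ; j (suc k , e) → k , e })
         (λ { j (k , e) → suc k , e }) ⟩
  count (taken? (s ∘ suc))
    ≡⟨ count-taken-weaklyIncr (s ∘ suc) (weaklyIncr-tail incr) ⟩
  suc (jumps (s ∘ suc))
    ≡⟨ cong (λ b → suc (b ℕ.+ jumps (s ∘ suc))) (𝟙-no (s 0F F.<? s 1F) (Fₚ.<-irrefl s₀≡s₁)) ⟨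
  suc (jumps s) ∎
  where open ≡-Reasoning
... | tri> _ _ s₁<s₀ = ⊥-elim (ℕₚ.<⇒≱ s₁<s₀ (incr 0F 1F refl))

InitialRunAscending : (Fin n → Fin m) → (Fin n → Fin N) → Set
InitialRunAscending {zero}        p s = ⊤
InitialRunAscending {suc zero}    p s = ⊤
InitialRunAscending {suc (suc n)} p s = s 0F ≡ s 1F → p 0F F.< p 1F × InitialRunAscending (p ∘ suc) (s ∘ suc)

admissible-cons : (p : Fin (suc (suc n)) → Fin m) (s : Fin (suc (suc n)) → Fin N) →
  s 0F F.≤ s 1F → (Admissible (p ∘ suc) (s ∘ suc) → PeakCond₁ p s) →
  Admissible p s ⇔ Admissible (p ∘ suc) (s ∘ suc)
admissible-cons p s s₀≤s₁ peak = mk⇔ (proj₂ ∘ proj₂) (λ adm → s₀≤s₁ , peak adm , adm)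

peakCond₁-jump : (p : Fin (suc (suc n)) → Fin m) (s : Fin (suc (suc n)) → Fin N) →
  s 0F F.< s 1F → Admissible (p ∘ suc) (s ∘ suc) → PeakCond₁ p s
peakCond₁-jump {zero}  p s s₀<s₁ _            = tt
peakCond₁-jump {suc n} p s s₀<s₁ (s₁≤s₂ , _) _ _ = ℕₚ.<-≤-trans s₀<s₁ s₁≤s₂

peakCond₁-tie-ascent : (p : Fin (suc (suc n)) → Fin m) (s : Fin (suc (suc n)) → Fin N) →
  s 0F ≡ s 1F → InitialRunAscending (p ∘ suc) (s ∘ suc) → Admissible (p ∘ suc) (s ∘ suc) → PeakCond₁ p s
peakCond₁-tie-ascent {zero}  p s _     _      _           = tt
peakCond₁-tie-ascent {suc n} p s s₀≡s₁ ascend (s₁≤s₂ , _) _ p₂<p₁ =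
  subst (F._< s 2F) (sym s₀≡s₁) (Fₚ.≤∧≢⇒< s₁≤s₂ λ s₁≡s₂ → Fₚ.<-asym (proj₁ (ascend s₁≡s₂)) p₂<p₁)

peakCond₁-descent : (p : Fin (suc (suc n)) → Fin m) (s : Fin (suc (suc n)) → Fin N) → p 1F F.< p 0F → PeakCond₁ p s
peakCond₁-descent {zero}  p s _     = tt
peakCond₁-descent {suc n} p s p₁<p₀ p₀<p₁ _ = ⊥-elim (Fₚ.<-asym p₀<p₁ p₁<p₀)

-- The first descent inside the run follows an ascent, so it sits at a peak with equal neighbours.
¬admissible-tie-ascent : (p : Fin (suc (suc n)) → Fin m) (s : Fin (suc (suc n)) → Fin N) → Injective _≡_ _≡_ p →
  s 0F ≡ s 1F → p 0F F.< p 1F → ¬ InitialRunAscending (p ∘ suc) (s ∘ suc) → ¬ Admissible p s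
¬admissible-tie-ascent {zero}  p s inj _ _ ¬ascend _ = ¬ascend tt
¬admissible-tie-ascent {suc n} p s inj s₀≡s₁ p₀<p₁ ¬ascend (_ , peak , adm) with s 1F F.≟ s 2F
... | no s₁≢s₂ = ¬ascend λ s₁≡s₂ → ⊥-elim (s₁≢s₂ s₁≡s₂)
... | yes s₁≡s₂ with ≢⇒<⊎> {a = p 1F} {p 2F} (Fₚ.0≢1+n ∘ Fₚ.suc-injective ∘ inj)
...   | inj₂ p₂<p₁ = Fₚ.<-irrefl (trans s₀≡s₁ s₁≡s₂) (peak p₀<p₁ p₂<p₁)
...   | inj₁ p₁<p₂ =
  ¬admissible-tie-ascent (p ∘ suc) (s ∘ suc) (Fₚ.suc-injective ∘ inj) s₁≡s₂ p₁<p₂ (λ ascend → ¬ascend λ _ → p₁<p₂ , ascend) adm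

negatives : Vector Sign n → ℕ
negatives σ = count (λ i → σ i ≟ˢ neg)

module SignSums {c ℓ} (R : CommutativeRing c ℓ) (q : CommutativeRing.Carrier R) where
  open CommutativeRing R renaming (refl to ≈-refl; sym to ≈-sym; trans to ≈-trans) hiding (zero)
  open Coefficients R using (pow)
  open RingSums R
  open import Algebra.Properties.CommutativeSemigroup *-commutativeSemigroup using (x∙yz≈y∙xz; interchange)
  open import Relation.Binary.Reasoning.Setoid setoid

  pow-+ : ∀ x a b → pow x (a ℕ.+ b) ≈ pow x a * pow x b
  pow-+ x zero    b = ≈-sym (*-identityˡ _)
  pow-+ x (suc a) b = ≈-trans (*-congˡ (pow-+ x a b)) (≈-sym (*-assoc _ _ _))

  signedWeight : (Fin n → Fin m) → (Fin n → Fin N) → Vector Sign n → Carrier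
  signedWeight p s σ = [ enrichedChain? p (zip σ s) ]· pow q (negatives σ)

  startingWith : Sign → (Fin (suc n) → Fin m) → (Fin (suc n) → Fin N) → Carrier
  startingWith {n} x p s = ∑[ σ ∈ allFuns signs n ] signedWeight p s (x ∷ᵛ σ)

  continuing : Sign → (Fin (suc (suc n)) → Fin m) → (Fin (suc (suc n)) → Fin N) → Carrier
  continuing x p s =
    ∑[ y ∈ signs ] [ enrichedPair? (p 0F) (p 1F) (x , s 0F) (y , s 1F) ]· startingWith y (p ∘ suc) (s ∘ suc)

  -- jumps s counts the runs of s after the first: this is a right-hand side term without the
  -- factor q + 1 of the first run.
  reducedWeight : (Fin n → Fin m) → (Fin n → Fin N) → Carrier
  reducedWeight p s = [ admissible? p s ]· (pow q (equalDescents p s) * pow (q + 1#) (jumps s))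

  startingWith-cons : ∀ x (p : Fin (suc (suc n)) → Fin m) (s : Fin (suc (suc n)) → Fin N) →
    startingWith x p s ≈ pow q (𝟙 (x ≟ˢ neg)) * continuing x p s
  startingWith-cons {n} x p s = begin
    startingWith x p s
      ≈⟨ ∑-allFuns-suc signs n _ ⟩
    ∑[ y ∈ signs ] ∑[ σ ∈ allFuns signs n ] signedWeight p s (x ∷ᵛ y ∷ᵛ σ)
      ≈⟨ ∑-cong signs (λ y → ∑-cong (allFuns signs n) (signedWeight-cons y)) ⟩
    ∑[ y ∈ signs ] ∑[ σ ∈ allFuns signs n ] qˣ * [ pair? y ]· signedWeight (p ∘ suc) (s ∘ suc) (y ∷ᵛ σ)
      ≈⟨ ∑-cong signs (λ y → ≈-trans (∑-*ˡ (allFuns signs n) qˣ _)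
                                       (*-congˡ (∑-· (allFuns signs n) (pair? y) (λ σ → signedWeight (p ∘ suc) (s ∘ suc) (y ∷ᵛ σ))))) ⟩
    ∑[ y ∈ signs ] qˣ * [ pair? y ]· startingWith y (p ∘ suc) (s ∘ suc)
      ≈⟨ ∑-*ˡ signs qˣ (λ y → [ pair? y ]· startingWith y (p ∘ suc) (s ∘ suc)) ⟩
    qˣ * continuing x p s ∎
    where
    qˣ = pow q (𝟙 (x ≟ˢ neg))
    pair? = λ y → enrichedPair? (p 0F) (p 1F) (x , s 0F) (y , s 1F)
    signedWeight-cons : ∀ y σ →
      signedWeight p s (x ∷ᵛ y ∷ᵛ σ) ≈ qˣ * [ pair? y ]· signedWeight (p ∘ suc) (s ∘ suc) (y ∷ᵛ σ)
    signedWeight-cons y σ = begin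
      [ pair? y ×-dec chain? ]· pow q (𝟙 (x ≟ˢ neg) ℕ.+ negatives (y ∷ᵛ σ))
        ≈⟨ ·-×-dec (pair? y) chain? (pow q (𝟙 (x ≟ˢ neg) ℕ.+ negatives (y ∷ᵛ σ))) ⟩
      [ pair? y ]· [ chain? ]· pow q (𝟙 (x ≟ˢ neg) ℕ.+ negatives (y ∷ᵛ σ))
        ≈⟨ ·-congʳ (pair? y) (λ _ → ·-congʳ chain? (λ _ → pow-+ q (𝟙 (x ≟ˢ neg)) (negatives (y ∷ᵛ σ)))) ⟩
      [ pair? y ]· [ chain? ]· (qˣ * pow q (negatives (y ∷ᵛ σ)))
        ≈⟨ ·-congʳ (pair? y) (λ _ → ≈-sym (*-·-comm chain? qˣ _)) ⟩
      [ pair? y ]· (qˣ * signedWeight (p ∘ suc) (s ∘ suc) (y ∷ᵛ σ))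
        ≈⟨ *-·-comm (pair? y) qˣ _ ⟨
      qˣ * [ pair? y ]· signedWeight (p ∘ suc) (s ∘ suc) (y ∷ᵛ σ) ∎
      where chain? = enrichedChain? (p ∘ suc) (zip (y ∷ᵛ σ) (s ∘ suc))

  startingWith-pos : (p : Fin (suc (suc n)) → Fin m) (s : Fin (suc (suc n)) → Fin N) →
    startingWith pos p s ≈ continuing pos p s
  startingWith-pos p s = ≈-trans (startingWith-cons pos p s) (*-identityˡ _)

  startingWith-neg : (p : Fin (suc (suc n)) → Fin m) (s : Fin (suc (suc n)) → Fin N) →
    startingWith neg p s ≈ q * continuing neg p s
  startingWith-neg p s = ≈-trans (startingWith-cons neg p s) (*-congʳ (*-identityʳ q))

  module _ (p : Fin (suc (suc n)) → Fin m) (s : Fin (suc (suc n)) → Fin N) where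
    private
      p′ = p ∘ suc
      s′ = s ∘ suc
      total′ = startingWith pos p′ s′ + (startingWith neg p′ s′ + 0#)
      pair? = λ x y → enrichedPair? (p 0F) (p 1F) (x , s 0F) (y , s 1F)

    continuing-jump : ∀ x → s 0F F.< s 1F → continuing x p s ≈ total′
    continuing-jump x s₀<s₁ = +-cong (·-yes (pair? x pos) (pair-jump s₀<s₁)) (+-congʳ (·-yes (pair? x neg) (pair-jump s₀<s₁)))

    continuing-drop : ∀ x → p 0F ≢ p 1F → s 1F F.< s 0F → continuing x p s ≈ 0#
    continuing-drop x p₀≢p₁ s₁<s₀ = begin
      continuing x p s ≈⟨ +-cong (·-no (pair? x pos) (pair-drop p₀≢p₁ s₁<s₀)) (+-congʳ (·-no (pair? x neg) (pair-drop p₀≢p₁ s₁<s₀))) ⟩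
      0# + (0# + 0#)   ≈⟨ +-identityˡ _ ⟩
      0# + 0#          ≈⟨ +-identityˡ _ ⟩
      0#               ∎

    continuing-tie-ascent : ∀ x → s 0F ≡ s 1F → p 0F F.< p 1F → continuing x p s ≈ startingWith pos p′ s′
    continuing-tie-ascent x s₀≡s₁ p₀<p₁ = begin
      continuing x p s
        ≈⟨ +-cong (·-yes (pair? x pos) (Equivalence.from (pair-tie-ascent s₀≡s₁ p₀<p₁) refl))
                  (+-congʳ (·-no (pair? x neg) λ pair → pos≢neg (Equivalence.to (pair-tie-ascent s₀≡s₁ p₀<p₁) pair))) ⟩
      startingWith pos p′ s′ + (0# + 0#) ≈⟨ +-congˡ (+-identityˡ 0#) ⟩
      startingWith pos p′ s′ + 0#        ≈⟨ +-identityʳ _ ⟩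
      startingWith pos p′ s′             ∎
      where
      pos≢neg : neg ≢ pos
      pos≢neg ()

    continuing-pos-tie-descent : s 0F ≡ s 1F → p 1F F.< p 0F → continuing pos p s ≈ 0#
    continuing-pos-tie-descent s₀≡s₁ p₁<p₀ = begin
      continuing pos p s ≈⟨ +-cong (·-no (pair? pos pos) (¬neg ∘ to)) (+-congʳ (·-no (pair? pos neg) (¬neg ∘ to))) ⟩
      0# + (0# + 0#)     ≈⟨ +-identityˡ _ ⟩
      0# + 0#            ≈⟨ +-identityˡ _ ⟩
      0#                 ∎
      where
      to : ∀ {y} → EnrichedPair (p 0F) (p 1F) (pos , s 0F) (y , s 1F) → pos ≡ neg
      to = Equivalence.to (pair-tie-descent s₀≡s₁ p₁<p₀)
      ¬neg : pos ≢ neg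
      ¬neg ()

    continuing-neg-tie-descent : s 0F ≡ s 1F → p 1F F.< p 0F → continuing neg p s ≈ total′
    continuing-neg-tie-descent s₀≡s₁ p₁<p₀ =
      +-cong (·-yes (pair? neg pos) (from refl)) (+-congʳ (·-yes (pair? neg neg) (from refl)))
      where
      from : ∀ {y} → neg ≡ neg → EnrichedPair (p 0F) (p 1F) (neg , s 0F) (y , s 1F)
      from = Equivalence.from (pair-tie-descent s₀≡s₁ p₁<p₀)

    reducedWeight-cons : s 0F F.≤ s 1F → (Admissible p′ s′ → PeakCond₁ p s) →
      reducedWeight p s ≈ (pow q (𝟙 (descentTie? p s)) * pow (q + 1#) (𝟙 (s 0F F.<? s 1F))) * reducedWeight p′ s′
    reducedWeight-cons s₀≤s₁ peak = begin
      [ admissible? p s ]· (pow q (d ℕ.+ equalDescents p′ s′) * pow (q + 1#) (j ℕ.+ jumps s′))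
        ≈⟨ ·-cong (admissible? p s) (admissible? p′ s′) (Equivalence.to adm⇔) (Equivalence.from adm⇔)
             (*-cong (pow-+ q d _) (pow-+ (q + 1#) j _)) ⟩
      [ admissible? p′ s′ ]· ((pow q d * pow q (equalDescents p′ s′)) * (pow (q + 1#) j * pow (q + 1#) (jumps s′)))
        ≈⟨ ·-congʳ (admissible? p′ s′) (λ _ → interchange _ _ _ _) ⟩
      [ admissible? p′ s′ ]· ((pow q d * pow (q + 1#) j) * (pow q (equalDescents p′ s′) * pow (q + 1#) (jumps s′)))
        ≈⟨ *-·-comm (admissible? p′ s′) _ _ ⟨
      (pow q d * pow (q + 1#) j) * reducedWeight p′ s′ ∎
      where
      d = 𝟙 (descentTie? p s)
      j = 𝟙 (s 0F F.<? s 1F)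
      adm⇔ = admissible-cons p s s₀≤s₁ peak

  -- The first letter is either unconstrained (free) or forced negative by a descent inside its
  -- run of equal values (forced).
  data SignSplit (p : Fin (suc n) → Fin m) (s : Fin (suc n) → Fin N) : Set ℓ where
    free   : InitialRunAscending p s → startingWith pos p s ≈ reducedWeight p s →
             startingWith neg p s ≈ q * reducedWeight p s → SignSplit p s
    forced : ¬ InitialRunAscending p s → startingWith pos p s ≈ 0# →
             startingWith neg p s ≈ (q + 1#) * reducedWeight p s → SignSplit p s

  signSplit-total : {p : Fin (suc n) → Fin m} {s : Fin (suc n) → Fin N} → SignSplit p s →
    startingWith pos p s + (startingWith neg p s + 0#) ≈ (q + 1#) * reducedWeight p s
  signSplit-total {p = p} {s} (free _ T₊≈ T₋≈) = begin
    startingWith pos p s + (startingWith neg p s + 0#) ≈⟨ +-cong T₊≈ (≈-trans (+-identityʳ _) T₋≈) ⟩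
    G + q * G                                          ≈⟨ +-comm G (q * G) ⟩
    q * G + G                                          ≈⟨ +-congˡ (*-identityˡ G) ⟨
    q * G + 1# * G                                     ≈⟨ distribʳ G q 1# ⟨
    (q + 1#) * G                                       ∎
    where G = reducedWeight p s
  signSplit-total (forced _ T₊≈ T₋≈) = ≈-trans (+-cong T₊≈ (≈-trans (+-identityʳ _) T₋≈)) (+-identityˡ _)

  module _ (p : Fin (suc (suc n)) → Fin m) (s : Fin (suc (suc n)) → Fin N) where
    private
      p′ = p ∘ suc
      s′ = s ∘ suc

      weight-factor : ∀ {d j} → 𝟙 (descentTie? p s) ≡ d → 𝟙 (s 0F F.<? s 1F) ≡ j →
        pow q (𝟙 (descentTie? p s)) * pow (q + 1#) (𝟙 (s 0F F.<? s 1F)) ≈ pow q d * pow (q + 1#) j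
      weight-factor refl refl = ≈-refl

      continuing-uniform : (∀ x → continuing x p s ≈ reducedWeight p s) →
        startingWith pos p s ≈ reducedWeight p s × startingWith neg p s ≈ q * reducedWeight p s
      continuing-uniform c = ≈-trans (startingWith-pos p s) (c pos) , ≈-trans (startingWith-neg p s) (*-congˡ (c neg))

    signSplit-jump : s 0F F.< s 1F → SignSplit p′ s′ → SignSplit p s
    signSplit-jump s₀<s₁ split′ = free (λ s₀≡s₁ → ⊥-elim (Fₚ.<-irrefl s₀≡s₁ s₀<s₁)) (proj₁ uniform) (proj₂ uniform)
      where
      reducedWeight-jump : reducedWeight p s ≈ (q + 1#) * reducedWeight p′ s′
      reducedWeight-jump = ≈-trans (reducedWeight-cons p s (ℕₚ.<⇒≤ s₀<s₁) (peakCond₁-jump p s s₀<s₁))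
        (*-congʳ (≈-trans (weight-factor (𝟙-no (descentTie? p s) λ (_ , s₀≡s₁) → Fₚ.<-irrefl s₀≡s₁ s₀<s₁)
                                         (𝟙-yes (s 0F F.<? s 1F) s₀<s₁))
                          (≈-trans (*-identityˡ _) (*-identityʳ _))))
      uniform = continuing-uniform λ x →
        ≈-trans (continuing-jump p s x s₀<s₁) (≈-trans (signSplit-total split′) (≈-sym reducedWeight-jump))

    signSplit-drop : p 0F ≢ p 1F → s 1F F.< s 0F → SignSplit p s
    signSplit-drop p₀≢p₁ s₁<s₀ = free (λ s₀≡s₁ → ⊥-elim (Fₚ.<-irrefl (sym s₀≡s₁) s₁<s₀)) (proj₁ uniform) (proj₂ uniform)
      where
      uniform = continuing-uniform λ x →
        ≈-trans (continuing-drop p s x p₀≢p₁ s₁<s₀) (≈-sym (·-no (admissible? p s) λ (s₀≤s₁ , _) → ℕₚ.<⇒≱ s₁<s₀ s₀≤s₁))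

    signSplit-tie-ascent : Injective _≡_ _≡_ p → s 0F ≡ s 1F → p 0F F.< p 1F → SignSplit p′ s′ → SignSplit p s
    signSplit-tie-ascent inj s₀≡s₁ p₀<p₁ (free ascend′ T₊≈ _) = free (λ _ → p₀<p₁ , ascend′) (proj₁ uniform) (proj₂ uniform)
      where
      reducedWeight-tie : reducedWeight p s ≈ reducedWeight p′ s′
      reducedWeight-tie = ≈-trans (reducedWeight-cons p s (Fₚ.≤-reflexive s₀≡s₁) (peakCond₁-tie-ascent p s s₀≡s₁ ascend′))
        (≈-trans (*-congʳ (≈-trans (weight-factor (𝟙-no (descentTie? p s) λ (p₁<p₀ , _) → Fₚ.<-asym p₀<p₁ p₁<p₀)
                                                  (𝟙-no (s 0F F.<? s 1F) (Fₚ.<-irrefl s₀≡s₁)))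
                                   (*-identityˡ 1#)))
                 (*-identityˡ _))
      uniform = continuing-uniform λ x →
        ≈-trans (continuing-tie-ascent p s x s₀≡s₁ p₀<p₁) (≈-trans T₊≈ (≈-sym reducedWeight-tie))
    signSplit-tie-ascent inj s₀≡s₁ p₀<p₁ (forced ¬ascend′ T₊≈ _) =
      forced (λ ascend → ¬ascend′ (proj₂ (ascend s₀≡s₁))) (≈-trans (proj₁ uniform) G≈0) (begin
        startingWith neg p s ≈⟨ proj₂ uniform ⟩
        q * G                ≈⟨ *-congˡ G≈0 ⟩
        q * 0#               ≈⟨ zeroʳ q ⟩
        0#                   ≈⟨ zeroʳ (q + 1#) ⟨
        (q + 1#) * 0#        ≈⟨ *-congˡ G≈0 ⟨
        (q + 1#) * G         ∎)
      where
      G = reducedWeight p s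
      G≈0 : G ≈ 0#
      G≈0 = ·-no (admissible? p s) (¬admissible-tie-ascent p s inj s₀≡s₁ p₀<p₁ ¬ascend′)
      uniform = continuing-uniform λ x →
        ≈-trans (continuing-tie-ascent p s x s₀≡s₁ p₀<p₁) (≈-trans T₊≈ (≈-sym G≈0))

    signSplit-tie-descent : s 0F ≡ s 1F → p 1F F.< p 0F → SignSplit p′ s′ → SignSplit p s
    signSplit-tie-descent s₀≡s₁ p₁<p₀ split′ =
      forced (λ ascend → Fₚ.<-asym (proj₁ (ascend s₀≡s₁)) p₁<p₀)
        (≈-trans (startingWith-pos p s) (continuing-pos-tie-descent p s s₀≡s₁ p₁<p₀)) (begin
        startingWith neg p s          ≈⟨ startingWith-neg p s ⟩
        q * continuing neg p s        ≈⟨ *-congˡ (continuing-neg-tie-descent p s s₀≡s₁ p₁<p₀) ⟩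
        q * (startingWith pos p′ s′ + (startingWith neg p′ s′ + 0#)) ≈⟨ *-congˡ (signSplit-total split′) ⟩
        q * ((q + 1#) * reducedWeight p′ s′) ≈⟨ x∙yz≈y∙xz q (q + 1#) _ ⟩
        (q + 1#) * (q * reducedWeight p′ s′) ≈⟨ *-congˡ reducedWeight-tie ⟨
        (q + 1#) * reducedWeight p s      ∎)
      where
      reducedWeight-tie : reducedWeight p s ≈ q * reducedWeight p′ s′
      reducedWeight-tie = ≈-trans (reducedWeight-cons p s (Fₚ.≤-reflexive s₀≡s₁) (λ _ → peakCond₁-descent p s p₁<p₀))
        (*-congʳ (≈-trans (weight-factor (𝟙-yes (descentTie? p s) (p₁<p₀ , s₀≡s₁)) (𝟙-no (s 0F F.<? s 1F) (Fₚ.<-irrefl s₀≡s₁)))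
                          (≈-trans (*-identityʳ _) (*-identityʳ q))))

  signSplit : (p : Fin (suc n) → Fin m) (s : Fin (suc n) → Fin N) → Injective _≡_ _≡_ p → SignSplit p s
  signSplit {zero}  p s _   = free tt (≈-trans (+-identityʳ 1#) (≈-sym (*-identityʳ 1#)))
                                      (≈-trans (+-identityʳ _) (*-congˡ (≈-sym (*-identityʳ 1#))))
  signSplit {suc n} p s inj with Fₚ.<-cmp (s 0F) (s 1F) | ≢⇒<⊎> (Fₚ.0≢1+n ∘ inj)
  ... | tri< s₀<s₁ _ _ | _          = signSplit-jump p s s₀<s₁ split′
    where split′ = signSplit (p ∘ suc) (s ∘ suc) (Fₚ.suc-injective ∘ inj)
  ... | tri> _ _ s₁<s₀ | _          = signSplit-drop p s (Fₚ.0≢1+n ∘ inj) s₁<s₀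
  ... | tri≈ _ s₀≡s₁ _ | inj₁ p₀<p₁ = signSplit-tie-ascent p s inj s₀≡s₁ p₀<p₁ split′
    where split′ = signSplit (p ∘ suc) (s ∘ suc) (Fₚ.suc-injective ∘ inj)
  ... | tri≈ _ s₀≡s₁ _ | inj₂ p₁<p₀ = signSplit-tie-descent p s s₀≡s₁ p₁<p₀ split′
    where split′ = signSplit (p ∘ suc) (s ∘ suc) (Fₚ.suc-injective ∘ inj)

  ∑-signedWeight : (p : Fin n → Fin m) (s : Fin n → Fin N) → Injective _≡_ _≡_ p →
    ∑ (allFuns signs n) (signedWeight p s) ≈
    [ admissible? p s ]· (pow q (equalDescents p s) * pow (q + 1#) (distinctCount s))
  ∑-signedWeight {zero} p s _ =
    ≈-trans (+-identityʳ 1#) (≈-trans (≈-sym (*-identityʳ 1#)) (*-congˡ (reflexive (cong (pow (q + 1#)) (sym no-values)))))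
    where
    no-values : distinctCount s ≡ 0
    no-values = trans (length-filter-allFin (taken? s)) (count-none (taken? s) λ { _ (() , _) })
  ∑-signedWeight {suc n} p s inj = begin
    ∑ (allFuns signs (suc n)) (signedWeight p s)
      ≈⟨ ∑-allFuns-suc signs n (signedWeight p s) ⟩
    startingWith pos p s + (startingWith neg p s + 0#)
      ≈⟨ signSplit-total (signSplit p s inj) ⟩
    (q + 1#) * reducedWeight p s
      ≈⟨ *-·-comm (admissible? p s) (q + 1#) _ ⟩
    [ admissible? p s ]· ((q + 1#) * (pow q (equalDescents p s) * pow (q + 1#) (jumps s)))
      ≈⟨ ·-congʳ (admissible? p s) (λ adm → ≈-trans (x∙yz≈y∙xz _ _ _)
           (*-congˡ (reflexive (cong (pow (q + 1#)) (sym (distinctCount-admissible adm)))))) ⟩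
    [ admissible? p s ]· (pow q (equalDescents p s) * pow (q + 1#) (distinctCount s)) ∎
    where
    distinctCount-admissible : Admissible p s → distinctCount s ≡ suc (jumps s)
    distinctCount-admissible adm =
      trans (length-filter-allFin (taken? s)) (count-taken-weaklyIncr s (admissible⇒weaklyIncr p s adm))

-- expU and expR are sums of local with-functions of Defs that cannot be named; the equation
-- argument lets unification recover them, so that facts about their summands can be stated.
SummandsOf : {g : Fin n → ℕ} → Σℕ n g ≡ Σℕ n g → (Fin n → ℕ) → Set
SummandsOf {g = g} _ h = ∀ i → g i ≡ h i

Σℕ-summands : {g h : Fin n → ℕ} → (∀ i → g i ≡ h i) → Σℕ n g ≡ sum h
Σℕ-summands {g = g} g≗h = trans (Σℕ≡sum g) (sum-cong-≗ g≗h)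

expU-summands : (π : Permutation′ n) (α : Fin n → ℕ) (f : Fin n → PM N) (j : Fin N) →
  SummandsOf (refl {x = expU π α f j}) (λ i → 𝟙 (proj₂ (f i) F.≟ j) ℕ.* ε π α i)
expU-summands π α f j i with proj₂ (f i) F.≟ j
... | yes _ = sym (ℕₚ.+-identityʳ _)
... | no _  = refl

expR-summands : (α : Fin n → ℕ) (s : Fin n → Fin N) (j : Fin N) →
  SummandsOf (refl {x = expR α s j}) (λ k → 𝟙 (s k F.≟ j) ℕ.* α k)
expR-summands α s j k with s k F.≟ j
... | yes _ = sym (ℕₚ.+-identityʳ _)
... | no _  = refl

expU-cong : (π : Permutation′ n) (α : Fin n → ℕ) {f g : Fin n → PM N} → f ≗ g → ∀ j → expU π α f j ≡ expU π α g j
expU-cong π α {f} {g} f≗g j = begin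
  expU π α f j                                        ≡⟨ Σℕ-summands (expU-summands π α f j) ⟩
  sum (λ i → 𝟙 (proj₂ (f i) F.≟ j) ℕ.* ε π α i)      ≡⟨ sum-cong-≗ (λ i → cong (λ u → 𝟙 (proj₂ u F.≟ j) ℕ.* ε π α i) (f≗g i)) ⟩
  sum (λ i → 𝟙 (proj₂ (g i) F.≟ j) ℕ.* ε π α i)      ≡⟨ Σℕ-summands (expU-summands π α g j) ⟨
  expU π α g j                                        ∎
  where open ≡-Reasoning

expU-zip : (π : Permutation′ n) (α : Fin n → ℕ) (σ : Vector Sign n) (s : Fin n → Fin N) →
  ∀ j → expU π α (zip σ s ∘ (π ⟨$⟩ˡ_)) j ≡ expR α s j
expU-zip π α σ s j = begin
  expU π α (zip σ s ∘ (π ⟨$⟩ˡ_)) j                 ≡⟨ Σℕ-summands (expU-summands π α (zip σ s ∘ (π ⟨$⟩ˡ_)) j) ⟩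
  sum (λ i → 𝟙 (s (π ⟨$⟩ˡ i) F.≟ j) ℕ.* α (π ⟨$⟩ˡ i)) ≡⟨ sum-permute (λ k → 𝟙 (s k F.≟ j) ℕ.* α k) (Perm.flip π) ⟨
  sum (λ k → 𝟙 (s k F.≟ j) ℕ.* α k)                 ≡⟨ Σℕ-summands (expR-summands α s j) ⟨
  expR α s j                                        ∎
  where open ≡-Reasoning

negCount≡count : (f : Fin n → PM N) → negCount f ≡ count (λ i → proj₁ (f i) ≟ˢ neg)
negCount≡count f = length-filter-allFin (λ i → proj₁ (f i) ≟ˢ neg)

negCount-zip : (π : Permutation′ n) (σ : Vector Sign n) (s : Fin n → Fin N) →
  negCount (zip σ s ∘ (π ⟨$⟩ˡ_)) ≡ negatives σ
negCount-zip π σ s = trans (negCount≡count (zip σ s ∘ (π ⟨$⟩ˡ_))) (sym (sum-permute (λ k → 𝟙 (σ k ≟ˢ neg)) (Perm.flip π)))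

negCount-cong : {f g : Fin n → PM N} → f ≗ g → negCount f ≡ negCount g
negCount-cong {f = f} {g} f≗g = begin
  negCount f                          ≡⟨ negCount≡count f ⟩
  count (λ i → proj₁ (f i) ≟ˢ neg)    ≡⟨ sum-cong-≗ (λ i → cong (λ u → 𝟙 (proj₁ u ≟ˢ neg)) (f≗g i)) ⟩
  count (λ i → proj₁ (g i) ≟ˢ neg)    ≡⟨ negCount≡count g ⟨
  negCount g                          ∎
  where open ≡-Reasoning

enriched-cong : (π : Permutation′ n) {f g : Fin n → PM N} → f ≗ g → Enriched π f → Enriched π g
enriched-cong π f≗g enr i j i<j = subst₂ (EnrichedPair i j) (f≗g i) (f≗g j) (enr i j i<j)

module Terms {c ℓ} (R : CommutativeRing c ℓ) (q : CommutativeRing.Carrier R)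
  {n N} (π : Permutation′ n) (α : Fin n → ℕ) (e : Fin N → ℕ) where
  open CommutativeRing R renaming (refl to ≈-refl; sym to ≈-sym; trans to ≈-trans) hiding (zero)
  open Coefficients R using (pow)
  open RingSums R
  open SignSums R q
  open import Relation.Binary.Reasoning.Setoid setoid

  termU : (Fin n → PM N) → Carrier
  termU f = [ enriched? π f ×-dec (expU π α f ≟ₑ e) ]· pow q (negCount f)

  termRHS : (Fin n → Fin N) → Carrier
  termRHS s = [ weaklyIncr? s ×-dec peakCond? π s ×-dec (expR α s ≟ₑ e) ]·
              (pow q (desEqCount π s) * pow (q + 1#) (distinctCount s))

  termU-extensional : Extensional termU
  termU-extensional {f} {g} f≗g =
    ·-cong (enriched? π f ×-dec (expU π α f ≟ₑ e)) (enriched? π g ×-dec (expU π α g ≟ₑ e))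
      (λ (enr , f↦e) → enriched-cong π f≗g enr , λ j → trans (sym (expU-cong π α f≗g j)) (f↦e j))
      (λ (enr , g↦e) → enriched-cong π (sym ∘ f≗g) enr , λ j → trans (expU-cong π α f≗g j) (g↦e j))
      (reflexive (cong (pow q) (negCount-cong f≗g)))

  termU-zip : ∀ σ s → termU (zip σ s ∘ (π ⟨$⟩ˡ_)) ≈ [ expR α s ≟ₑ e ]· signedWeight (π ⟨$⟩ʳ_) s σ
  termU-zip σ s = begin
    termU f
      ≈⟨ ·-×-dec (enriched? π f) (expU π α f ≟ₑ e) _ ⟩
    [ enriched? π f ]· [ expU π α f ≟ₑ e ]· pow q (negCount f)
      ≈⟨ ·-cong (enriched? π f) chain? (Equivalence.to (enriched⇔chain π (zip σ s))) (Equivalence.from (enriched⇔chain π (zip σ s)))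
           (·-cong (expU π α f ≟ₑ e) (expR α s ≟ₑ e)
              (λ f↦e j → trans (sym (expU-zip π α σ s j)) (f↦e j)) (λ s↦e j → trans (expU-zip π α σ s j) (s↦e j))
              (reflexive (cong (pow q) (negCount-zip π σ s)))) ⟩
    [ chain? ]· [ expR α s ≟ₑ e ]· pow q (negatives σ)
      ≈⟨ ·-comm chain? (expR α s ≟ₑ e) _ ⟩
    [ expR α s ≟ₑ e ]· signedWeight (π ⟨$⟩ʳ_) s σ ∎
    where
    f = zip σ s ∘ (π ⟨$⟩ˡ_)
    chain? = enrichedChain? (π ⟨$⟩ʳ_) (zip σ s)

  termRHS-admissible : ∀ s →
    [ expR α s ≟ₑ e ]· [ admissible? (π ⟨$⟩ʳ_) s ]· (pow q (equalDescents (π ⟨$⟩ʳ_) s) * pow (q + 1#) (distinctCount s)) ≈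
    termRHS s
  termRHS-admissible s = begin
    [ expR α s ≟ₑ e ]· [ admissible? p s ]· weight
      ≈⟨ ·-comm (expR α s ≟ₑ e) (admissible? p s) weight ⟩
    [ admissible? p s ]· [ expR α s ≟ₑ e ]· weight
      ≈⟨ ·-×-dec (admissible? p s) (expR α s ≟ₑ e) weight ⟨
    [ admissible? p s ×-dec (expR α s ≟ₑ e) ]· weight
      ≈⟨ ·-cong (admissible? p s ×-dec (expR α s ≟ₑ e)) (weaklyIncr? s ×-dec peakCond? π s ×-dec (expR α s ≟ₑ e))
           (λ (adm , s↦e) → admissible⇒weaklyIncr p s adm , admissible⇒peaksSeparated p s adm , s↦e)
           (λ (incr , peaks , s↦e) → weaklyIncr∧peaksSeparated⇒admissible p s incr peaks , s↦e)
           (*-congʳ (reflexive (cong (pow q) (sym desEqCount≡)))) ⟩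
    termRHS s ∎
    where
    p = π ⟨$⟩ʳ_
    weight = pow q (equalDescents p s) * pow (q + 1#) (distinctCount s)
    desEqCount≡ : desEqCount π s ≡ equalDescents p s
    desEqCount≡ = trans (length-filter-allFin (equalDescentAt? p s)) (count-equalDescentAt p s)

-- Positivity of α only matters for reading these coefficients as those of the power series.
proposition2p2 : ∀ {c ℓ} (R : CommutativeRing c ℓ) (q : CommutativeRing.Carrier R)
    (n : ℕ) (π : Permutation′ n) (α : Fin n → ℕ) → (∀ k → 1 ≤ α k) →
    ∀ (N : ℕ) (e : Fin N → ℕ) →
    CommutativeRing._≈_ R (Coefficients.coeffU R q π α N e) (Coefficients.coeffRHS R q π α N e)
proposition2p2 R q n π α _ N e = begin
  coeffU q π α N e
    ≈⟨ ∑-filter (λ f → enriched? π f ×-dec (expU π α f ≟ₑ e)) (allFuns (allPM N) n) (λ f → pow q (negCount f)) ⟩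
  ∑ (allFuns (allPM N) n) termU
    ≈⟨ ∑-allFuns-permute (allPM N) n (Perm.flip π) termU-extensional ⟨
  ∑[ f ∈ allFuns (allPM N) n ] termU (f ∘ (π ⟨$⟩ˡ_))
    ≈⟨ ∑-allFuns-zip signs (allFin N) n (λ f≗g → termU-extensional (f≗g ∘ (π ⟨$⟩ˡ_))) ⟩
  ∑[ s ∈ allFuns (allFin N) n ] ∑[ σ ∈ allFuns signs n ] termU (zip σ s ∘ (π ⟨$⟩ˡ_))
    ≈⟨ ∑-cong (allFuns (allFin N) n) (λ s →
         ≈-trans (∑-cong (allFuns signs n) (λ σ → termU-zip σ s)) (∑-· (allFuns signs n) (expR α s ≟ₑ e) _)) ⟩
  ∑[ s ∈ allFuns (allFin N) n ] [ expR α s ≟ₑ e ]· ∑ (allFuns signs n) (signedWeight (π ⟨$⟩ʳ_) s)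
    ≈⟨ ∑-cong (allFuns (allFin N) n) (λ s →
         ≈-trans (·-congʳ (expR α s ≟ₑ e) λ _ → ∑-signedWeight (π ⟨$⟩ʳ_) s (Injection.injective (↔⇒↣ π)))
                 (termRHS-admissible s)) ⟩
  ∑ (allFuns (allFin N) n) termRHS
    ≈⟨ ∑-filter (λ s → weaklyIncr? s ×-dec peakCond? π s ×-dec (expR α s ≟ₑ e)) (allFuns (allFin N) n)
                (λ s → pow q (desEqCount π s) * pow (q + 1#) (distinctCount s)) ⟨
  coeffRHS q π α N e ∎
  where
  open CommutativeRing R renaming (refl to ≈-refl; sym to ≈-sym; trans to ≈-trans) hiding (zero)
  open Coefficients R
  open RingSums R
  open SignSums R q
  open Terms R q π α e
  open import Relation.Binary.Reasoning.Setoid setoid
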